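{- Let $\mathsf P$ be a piece with basic move set $\mathcal M$, $\mathcal B$ a rational convex polygon, and $q\ge1$. Then each unlabelled nonattacking configuration type of $q$ pieces corresponds to exactly $q!$ labelled nonattacking configuration types; equivalently, the action of the symmetric group $S_q$ on labelled nonattacking configuration types by relabelling the pieces is free.
   Context: $\mathcal M$ is a nonempty finite set of nonzero vectors $m_r=(c_r,d_r)\in\mathbb Z^2$ with $\gcd(c_r,d_r)=1$, no two parallel; $m_r^\perp=(d_r,-c_r)$. $\mathcal B\subset\mathbb R^2$ is a closed two-dimensional convex polygon with rational vertices and interior $\mathcal B^\circ$. For a positive integer $t$, a labelled configuration is $\mathbf z=(z_1,\dots,z_q)$, $z_i\in t\mathcal B^\circ\cap\mathbb Z^2$, nonattacking if $(z_j-z_i)\cdot m_r^\perp\ne 0$ for all $i\ne j$ and all $r$. Its labelled configuration type is the family of sets $L_{ir}=\{j:(z_j-z_i)\cdot m_r^\perp>0\}$ (indices of pieces on the left side of the $r$th move line through piece $i$), for $i=1,\dots,q$ and $m_r\in\mathcal M$. Labelled nonattacking configuration types are those arising from some nonattacking labelled configuration for some $t$. Relabelling by $\sigma\in S_q$ sends $\mathbf z$ to $(z_{\sigma^{ -1}(1)},\dots,z_{\sigma^{ -1}(q)})$ and thus acts on types; an unlabelled configuration type is the type obtained by forgetting labels, i.e. an orbit of this action. -}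

module Defs where

open import Data.Nat using (ℕ; suc) renaming (_≤_ to _≤ℕ_)
open import Data.Integer using (ℤ; +_; _+_; _-_; _*_; _<_; _≤_; _<?_; ∣_∣; 0ℤ; 1ℤ)
open import Data.Integer.GCD using (gcd)
open import Data.Fin using (Fin)
open import Data.Fin.Subset using (Subset)
open import Data.Fin.Permutation using (Permutation′; _⟨$⟩ˡ_)
open import Data.Vec using (tabulate)
open import Data.Product using (_×_; _,_; proj₁; proj₂; ∃; ∃-syntax)
open import Relation.Nullary using (¬_; does)
open import Relation.Binary.PropositionalEquality using (_≡_; _≢_)

ℤ² : Set
ℤ² = ℤ × ℤ

_·_ : ℤ² → ℤ² → ℤ
(x , y) · (u , v) = x * u + y * v

_−²_ : ℤ² → ℤ² → ℤ²
(x , y) −² (u , v) = (x - u , y - v)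

perp : ℤ² → ℤ²
perp (c , d) = (d , Data.Integer.- c)

record MoveSet (k : ℕ) (m : Fin k → ℤ²) : Set where
  field
    nonempty    : 1 ≤ℕ k
    coprime     : ∀ r → gcd (proj₁ (m r)) (proj₂ (m r)) ≡ 1ℤ
    nonparallel : ∀ r s → r ≢ s → (m r) · perp (m s) ≢ 0ℤ

-- A rational convex polygon B = { x ∈ ℝ² : a_l · x ≤ b_l for all l },
-- given by n half-planes with integer (wlog, after scaling) data and a_l ≠ 0.
-- Rational points are written y / s with y ∈ ℤ², s ≥ 1.
record RationalPolygon (n : ℕ) (a : Fin n → ℤ²) (b : Fin n → ℤ) : Set where
  field
    normals-nonzero : ∀ l → a l ≢ (0ℤ , 0ℤ)
    full-dim : ∃[ y ] ∃[ s ] (1 ≤ℕ s × (∀ l → a l · y < (+ s) * b l))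
    bounded : ∃[ R ] (∀ (y : ℤ²) (s : ℕ) → 1 ≤ℕ s → (∀ l → a l · y ≤ (+ s) * b l) →
                       (∣ proj₁ y ∣ ≤ℕ s Data.Nat.* R) × (∣ proj₂ y ∣ ≤ℕ s Data.Nat.* R))

-- z ∈ t B° ∩ ℤ²  (interior of a full-dimensional polyhedron with nonzero
-- normals = points satisfying all inequalities strictly)
InDilatedInterior : ∀ {n} → (Fin n → ℤ²) → (Fin n → ℤ) → ℕ → ℤ² → Set
InDilatedInterior a b t z = ∀ l → a l · z < (+ t) * b l

Config : ℕ → Set
Config q = Fin q → ℤ²

Nonattacking : ∀ {k q} → (Fin k → ℤ²) → Config q → Set
Nonattacking m z = ∀ i j → i ≢ j → ∀ r → (z j −² z i) · perp (m r) ≢ 0ℤ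

ConfigType : ℕ → ℕ → Set
ConfigType k q = Fin q → Fin k → Subset q

configType : ∀ {k q} → (Fin k → ℤ²) → Config q → ConfigType k q
configType m z i r = tabulate (λ j → does (0ℤ <? (z j −² z i) · perp (m r)))

_≈T_ : ∀ {k q} → ConfigType k q → ConfigType k q → Set
T ≈T T′ = ∀ i r → T i r ≡ T′ i r

-- relabelling by σ : z ↦ (z_{σ⁻¹(1)}, …, z_{σ⁻¹(q)})
relabel : ∀ {q} → Permutation′ q → Config q → Config q
relabel σ z i = z (σ ⟨$⟩ˡ i)

module Submission where

-- Fix one basic move m r and its normal p = m r ⊥; the "height" of piece a is
-- z a · p.  Piece b lies on the left of the move line through piece a exactly
-- when a is strictly lower than b, so the configuration type records the
-- strict height order for the direction r.  If relabelling by σ leaves the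
-- type unchanged, the map π = σ⁻¹ preserves this strict order, and so does the
-- reversed order.  An endomap of a finite set that preserves a strict order
-- never moves a point strictly up: iterating it would produce an infinite
-- strictly increasing chain, contradicting the pigeonhole principle.  Hence
-- every piece a has the same height as π a; being nonattacking, two distinct
-- pieces never share a height, so π fixes every point, and so does σ.

open import Defs
open import Data.Nat using (ℕ; _≤_)
open import Data.Integer using (ℤ)
open import Data.Fin using (Fin)
open import Data.Fin.Permutation using (Permutation′; _⟨$⟩ʳ_)
open import Relation.Binary.PropositionalEquality using (_≡_)

import Data.Nat as ℕ
import Data.Nat.Properties as ℕP
import Data.Integer as ℤ
import Data.Integer.Properties as ℤP
open import Data.Integer.Tactic.RingSolver using (solve-∀)
import Data.Fin as Fin
open import Data.Fin.Properties using (pigeonhole)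
open import Data.Fin.Permutation using (_⟨$⟩ˡ_; inverseˡ)
open import Data.Vec using (lookup)
open import Data.Vec.Properties using (lookup∘tabulate)
open import Data.Product using (_,_)
open import Data.Sum using (inj₁; inj₂)
open import Data.Empty using (⊥-elim)
open import Function.Bundles using (_⇔_; mk⇔; Equivalence)
open import Function using (flip)
open import Level using (Level)
open import Relation.Nullary using (¬_; Dec; does; yes; no)
open import Relation.Binary.Core using (Rel)
open import Relation.Binary.Definitions using (Transitive; Irreflexive; tri<; tri≈; tri>)
open import Relation.Binary.PropositionalEquality
  using (refl; sym; trans; cong; subst; subst₂; module ≡-Reasoning)

-- An endomap f of Fin q preserving a strict order _≺_ admits no x with
-- x ≺ f x: the orbit x, f x, f (f x), … would be strictly increasing, but
-- among its first q + 1 points two coincide.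
module _ {ℓ : Level} {q : ℕ} {_≺_ : Rel (Fin q) ℓ}
         (≺-trans : Transitive _≺_) (≺-irrefl : Irreflexive _≡_ _≺_)
         (f : Fin q → Fin q) (f-mono : ∀ {x y} → x ≺ y → f x ≺ f y) where

  orbit : Fin q → ℕ → Fin q
  orbit x ℕ.zero    = x
  orbit x (ℕ.suc n) = f (orbit x n)

  orbit-step : ∀ {x} → x ≺ f x → ∀ n → orbit x n ≺ orbit x (ℕ.suc n)
  orbit-step x≺fx ℕ.zero    = x≺fx
  orbit-step x≺fx (ℕ.suc n) = f-mono (orbit-step x≺fx n)

  orbit-increasing : ∀ {x} → x ≺ f x → ∀ {i j} → i ℕ.< j → orbit x i ≺ orbit x j
  orbit-increasing x≺fx {i} {ℕ.suc j} i<1+j with ℕP.m<1+n⇒m<n∨m≡n i<1+j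
  ... | inj₁ i<j  = ≺-trans (orbit-increasing x≺fx i<j) (orbit-step x≺fx j)
  ... | inj₂ refl = orbit-step x≺fx i

  no-ascent : ∀ x → ¬ (x ≺ f x)
  no-ascent x x≺fx with pigeonhole (ℕP.n<1+n q) (λ n → orbit x (Fin.toℕ n))
  ... | _ , _ , i<j , same-point = ≺-irrefl same-point (orbit-increasing x≺fx i<j)

0<j-i⇒i<j : ∀ {i j} → ℤ.0ℤ ℤ.< j ℤ.- i → i ℤ.< j
0<j-i⇒i<j {i} {j} 0<j-i =
  subst₂ ℤ._<_ (ℤP.+-identityˡ i) (cancel i j) (ℤP.+-monoˡ-< i 0<j-i)
  where
  cancel : ∀ i j → (j ℤ.- i) ℤ.+ i ≡ j
  cancel = solve-∀

i<j⇒0<j-i : ∀ {i j} → i ℤ.< j → ℤ.0ℤ ℤ.< j ℤ.- i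
i<j⇒0<j-i {i} {j} i<j =
  subst (ℤ._< j ℤ.- i) (ℤP.+-inverseʳ i) (ℤP.+-monoˡ-< (ℤ.- i) i<j)

·-sub : ∀ (u v p : ℤ²) → (u −² v) · p ≡ u · p ℤ.- v · p
·-sub (u₁ , u₂) (v₁ , v₂) (p₁ , p₂) = expand u₁ u₂ v₁ v₂ p₁ p₂
  where
  expand : ∀ u₁ u₂ v₁ v₂ p₁ p₂ →
           (u₁ ℤ.- v₁) ℤ.* p₁ ℤ.+ (u₂ ℤ.- v₂) ℤ.* p₂
             ≡ (u₁ ℤ.* p₁ ℤ.+ u₂ ℤ.* p₂) ℤ.- (v₁ ℤ.* p₁ ℤ.+ v₂ ℤ.* p₂)
  expand = solve-∀

does-transfer : ∀ {P Q : Set} (p? : Dec P) (q? : Dec Q) → does p? ≡ does q? → Q → P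
does-transfer (yes p) _       _  _ = p
does-transfer (no _) (yes _) ()  _
does-transfer (no _) (no ¬q) _  q = ⊥-elim (¬q q)

height : ∀ {k q} → (Fin k → ℤ²) → Fin k → Config q → Fin q → ℤ
height m r z a = z a · perp (m r)

left⇔lower : ∀ {k q} (m : Fin k → ℤ²) (r : Fin k) (z : Config q) (a b : Fin q) →
  (ℤ.0ℤ ℤ.< (z b −² z a) · perp (m r)) ⇔ (height m r z a ℤ.< height m r z b)
left⇔lower m r z a b = mk⇔
  (λ left  → 0<j-i⇒i<j (subst (ℤ.0ℤ ℤ.<_) (·-sub (z b) (z a) (perp (m r))) left))
  (λ lower → subst (ℤ.0ℤ ℤ.<_) (sym (·-sub (z b) (z a) (perp (m r)))) (i<j⇒0<j-i lower))

type-entry : ∀ {k q} (m : Fin k → ℤ²) (z : Config q) (a : Fin q) (r : Fin k) (b : Fin q) →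
  lookup (configType m z a r) b ≡ does (ℤ.0ℤ ℤ.<? (z b −² z a) · perp (m r))
type-entry m z a r b = lookup∘tabulate _ b

-- If relabelling by σ preserves the type, then π = σ⁻¹ preserves every
-- height order: relabel σ z a = z (π a), so the type of the relabelled
-- configuration compares π a with π b.
relabel-preserves-lower : ∀ {k q} (m : Fin k → ℤ²) (z : Config q) (σ : Permutation′ q) →
  configType m (relabel σ z) ≈T configType m z → ∀ r {a b} →
  height m r z a ℤ.< height m r z b →
  height m r z (σ ⟨$⟩ˡ a) ℤ.< height m r z (σ ⟨$⟩ˡ b)
relabel-preserves-lower {q = q} m z σ same r {a} {b} lower =
  Equivalence.to (left⇔lower m r z (π a) (π b))
    (does-transfer (ℤ.0ℤ ℤ.<? _) (ℤ.0ℤ ℤ.<? _) same-entry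
      (Equivalence.from (left⇔lower m r z a b) lower))
  where
  π : Fin q → Fin q
  π = σ ⟨$⟩ˡ_

  same-entry : does (ℤ.0ℤ ℤ.<? (z (π b) −² z (π a)) · perp (m r))
             ≡ does (ℤ.0ℤ ℤ.<? (z b −² z a) · perp (m r))
  same-entry = begin
    does (ℤ.0ℤ ℤ.<? (z (π b) −² z (π a)) · perp (m r)) ≡⟨ type-entry m (relabel σ z) a r b ⟨
    lookup (configType m (relabel σ z) a r) b          ≡⟨ cong (λ L → lookup L b) (same a r) ⟩
    lookup (configType m z a r) b                      ≡⟨ type-entry m z a r b ⟩
    does (ℤ.0ℤ ℤ.<? (z b −² z a) · perp (m r))         ∎
    where open ≡-Reasoning

same-height⇒same-piece : ∀ {k q} (m : Fin k → ℤ²) (r : Fin k) (z : Config q) →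
  Nonattacking m z → ∀ {a b} → height m r z a ≡ height m r z b → a ≡ b
same-height⇒same-piece m r z nonattacking {a} {b} level with a Fin.≟ b
... | yes a≡b = a≡b
... | no  a≢b = ⊥-elim (nonattacking a b a≢b r on-line)
  where
  on-line : (z b −² z a) · perp (m r) ≡ ℤ.0ℤ
  on-line = trans (·-sub (z b) (z a) (perp (m r))) (ℤP.i≡j⇒i-j≡0 (sym level))

-- If the type of a nonattacking configuration is invariant under relabelling
-- by σ, then σ⁻¹ fixes every piece: it can move no piece up (nor down) in the
-- height order of a chosen move r, and pieces of equal height coincide.
type-invariant⇒fixed : ∀ {k q} (m : Fin k → ℤ²) (r : Fin k) (z : Config q) →
  Nonattacking m z → (σ : Permutation′ q) →
  configType m (relabel σ z) ≈T configType m z → ∀ a → σ ⟨$⟩ˡ a ≡ a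
type-invariant⇒fixed {q = q} m r z nonattacking σ same = fixed
  where
  h : Fin q → ℤ
  h = height m r z

  π : Fin q → Fin q
  π = σ ⟨$⟩ˡ_

  preserves : ∀ {x y} → h x ℤ.< h y → h (π x) ℤ.< h (π y)
  preserves = relabel-preserves-lower m z σ same r

  below-irrefl : Irreflexive _≡_ (λ x y → h x ℤ.< h y)
  below-irrefl refl = ℤP.<-irrefl refl

  above-irrefl : Irreflexive _≡_ (λ x y → h y ℤ.< h x)
  above-irrefl refl = ℤP.<-irrefl refl

  fixed : ∀ a → π a ≡ a
  fixed a with ℤP.<-cmp (h a) (h (π a))
  ... | tri< up _ _    = ⊥-elim (no-ascent ℤP.<-trans below-irrefl π preserves a up)
  ... | tri≈ _ level _ = sym (same-height⇒same-piece m r z nonattacking level)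
  ... | tri> _ _ down  = ⊥-elim (no-ascent (flip ℤP.<-trans) above-irrefl π preserves a down)

-- Choose the first move (there is one, since
-- the move set is nonempty) and apply the previous lemma to σ ⟨$⟩ʳ i.
lemma5p1 : (k : ℕ) (m : Fin k → ℤ²) → MoveSet k m →
           (n : ℕ) (a : Fin n → ℤ²) (b : Fin n → ℤ) → RationalPolygon n a b →
           (q : ℕ) → 1 ≤ q →
           (t : ℕ) → 1 ≤ t → (z : Config q) → (∀ i → InDilatedInterior a b t (z i)) →
           Nonattacking m z →
           (σ : Permutation′ q) → configType m (relabel σ z) ≈T configType m z →
           ∀ i → σ ⟨$⟩ʳ i ≡ i
lemma5p1 ℕ.zero    m moves _ _ _ _ _ _ _ _ _ _ _ _ _ with MoveSet.nonempty moves
... | ()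
lemma5p1 (ℕ.suc k) m _ _ _ _ _ _ _ _ _ z _ nonattacking σ same i = begin
  σ ⟨$⟩ʳ i                  ≡⟨ type-invariant⇒fixed m Fin.zero z nonattacking σ same (σ ⟨$⟩ʳ i) ⟨
  σ ⟨$⟩ˡ (σ ⟨$⟩ʳ i)         ≡⟨ inverseˡ σ ⟩
  i                         ∎
  where open ≡-Reasoning
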